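{- Let $D$ be a digraph. The following are equivalent: (i) $\langle D\rangle$ is a right zero semigroup; (ii) $\langle D\rangle$ has a unique $\mathscr{R}$-class; (iii) $D$ has a unique non-trivial connected component $K$, and $K$ has exactly $2$ vertices.
   Context: For $a\neq b$ in $\{1,\ldots,n\}$, $(a\to b)$ denotes the transformation mapping $a$ to $b$ and fixing every other point; transformations are composed left to right. For a digraph $D$ on $\{1,\ldots,n\}$ (no loops, no multiple arcs), $\langle D\rangle$ is the semigroup generated by all $(a\to b)$ with $(a,b)$ an arc. Connected components are those of the underlying undirected graph; a component is non-trivial if it has more than one vertex. A right zero semigroup is one in which $ab=b$ for all $a,b$. $\mathscr{R}$ is Green's $\mathscr{R}$-relation. -}

module Defs where

open import Level using (0ℓ)
open import Data.Nat using (ℕ)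
open import Data.Fin using (Fin; _≟_)
open import Data.Product using (Σ; ∃; ∃-syntax; _×_; _,_)
open import Data.Sum using (_⊎_)
open import Relation.Nullary using (¬_; yes; no)
open import Relation.Binary.PropositionalEquality using (_≡_; _≢_)
open import Relation.Binary.Construct.Closure.Symmetric using (SymClosure)
open import Relation.Binary.Construct.Closure.ReflexiveTransitive using (Star)

-- A digraph on {1,…,n} (here Fin n): an arc relation with no loops.
-- (Multiple arcs are irrelevant: only the existence of an arc matters.)
record Digraph (n : ℕ) : Set₁ where
  field
    Arc       : Fin n → Fin n → Set
    loopless  : ∀ a → ¬ Arc a a

open Digraph public

Trans : ℕ → Set
Trans n = Fin n → Fin n

-- Composition left to right: x (f · g) = g (f x).
_·_ : ∀ {n} → Trans n → Trans n → Trans n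
(f · g) x = g (f x)

_≈_ : ∀ {n} → Trans n → Trans n → Set
f ≈ g = ∀ x → f x ≡ g x

⟦_⇒_⟧ : ∀ {n} → Fin n → Fin n → Trans n
⟦ a ⇒ b ⟧ x with x ≟ a
... | yes _ = b
... | no  _ = x

data ⟨_⟩ {n : ℕ} (D : Digraph n) : Trans n → Set where
  gen  : ∀ {a b} → Arc D a b → ⟨ D ⟩ ⟦ a ⇒ b ⟧
  comp : ∀ {f g} → ⟨ D ⟩ f → ⟨ D ⟩ g → ⟨ D ⟩ (f · g)

RightZero : ∀ {n} → Digraph n → Set
RightZero D = ∀ f g → ⟨ D ⟩ f → ⟨ D ⟩ g → (f · g) ≈ g

-- f ≤_R g in ⟨D⟩ : f ∈ g ⟨D⟩¹, i.e. f = g or f = g s for some s ∈ ⟨D⟩.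
_∈_·S¹[_] : ∀ {n} → Trans n → Trans n → Digraph n → Set
f ∈ g ·S¹[ D ] = (f ≈ g) ⊎ (∃[ s ] (⟨ D ⟩ s × f ≈ (g · s)))

Rrel : ∀ {n} → Digraph n → Trans n → Trans n → Set
Rrel D f g = (f ∈ g ·S¹[ D ]) × (g ∈ f ·S¹[ D ])

UniqueRClass : ∀ {n} → Digraph n → Set
UniqueRClass D = (∃[ f ] ⟨ D ⟩ f) × (∀ f g → ⟨ D ⟩ f → ⟨ D ⟩ g → Rrel D f g)

Connected : ∀ {n} → Digraph n → Fin n → Fin n → Set
Connected D = Star (SymClosure (Arc D))

-- D has a unique non-trivial connected component K, and K has exactly 2
-- vertices: there are distinct connected a, b such that every vertex x lying in a
-- non-trivial component (i.e. connected to some y ≠ x) is a or b.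
UniqueNontrivialComponentOfSize2 : ∀ {n} → Digraph n → Set
UniqueNontrivialComponentOfSize2 D =
  ∃[ a ] ∃[ b ] (a ≢ b × Connected D a b ×
    (∀ x y → x ≢ y → Connected D x y → (x ≡ a ⊎ x ≡ b)))

module Submission where

-- Proof structure.
--  * Elementary transformations: (a → b) sends a and b to b and fixes all
--    other points, so it identifies two distinct points only if one of them
--    is a or b; and (u → v)(u' → v') = (u' → v') whenever u, v ∈ {u', v'}.
--  * A semigroup is right zero as soon as its generators satisfy st = t.
--  * Condition (iii) for a pair {a, b} is equivalent to: every arc has both
--    endpoints in {a, b} (a vertex lies in a non-trivial component iff it is
--    an endpoint of an arc).
--  * (iii) ⇒ (i): any two arcs have the same endpoint set, so the generators
--    absorb each other from the left.  (i) ⇒ (ii) is immediate.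
--  * (ii) ⇒ (iii): if f ≤_R g then ker g ⊆ ker f.  Fixing an arc (a, b),
--    (a → b) R (u → v) for every arc (u, v), so (a → b) identifies u and v,
--    forcing u, v ∈ {a, b}.

open import Defs
open import Data.Nat using (ℕ)
open import Data.Fin using (Fin; _≟_)
open import Data.Product using (∃-syntax; _×_; _,_; proj₁; proj₂)
open import Data.Sum using (_⊎_; inj₁; inj₂)
open import Data.Empty using (⊥-elim)
open import Function.Bundles using (_⇔_; mk⇔)
open import Relation.Nullary using (Dec; yes; no)
open import Relation.Binary.PropositionalEquality
  using (_≡_; _≢_; refl; sym; trans; cong; ≢-sym; module ≡-Reasoning)
open import Relation.Binary.Construct.Closure.Symmetric using (fwd; bwd)
open import Relation.Binary.Construct.Closure.ReflexiveTransitive using (ε; _◅_)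

OneOf : ∀ {n} → Fin n → Fin n → Fin n → Set
OneOf a b x = x ≡ a ⊎ x ≡ b

module Elementary {n : ℕ} where

  ⇒-source : (a b : Fin n) → ⟦ a ⇒ b ⟧ a ≡ b
  ⇒-source a b with a ≟ a
  ... | yes _  = refl
  ... | no a≢a = ⊥-elim (a≢a refl)

  ⇒-fixes : ∀ {a b x : Fin n} → x ≢ a → ⟦ a ⇒ b ⟧ x ≡ x
  ⇒-fixes {a} {x = x} x≢a with x ≟ a
  ... | yes x≡a = ⊥-elim (x≢a x≡a)
  ... | no _    = refl

  ⇒-onPair : ∀ {a b w : Fin n} → OneOf a b w → ⟦ a ⇒ b ⟧ w ≡ b
  ⇒-onPair {a} {b} (inj₁ refl) = ⇒-source a b
  ⇒-onPair {a} {b} (inj₂ refl) with b ≟ a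
  ... | yes _ = refl
  ... | no  _ = refl

  ⇒-collapse : ∀ {a b x y : Fin n} →
               ⟦ a ⇒ b ⟧ x ≡ ⟦ a ⇒ b ⟧ y → x ≢ y → OneOf a b x
  ⇒-collapse {a} {b} {x} {y} same x≢y = cases (x ≟ a) (y ≟ a)
    where
      open ≡-Reasoning
      cases : Dec (x ≡ a) → Dec (y ≡ a) → OneOf a b x
      cases (yes x≡a) _          = inj₁ x≡a
      cases (no x≢a)  (yes refl) = inj₂ (begin
        x              ≡⟨ sym (⇒-fixes x≢a) ⟩
        ⟦ a ⇒ b ⟧ x    ≡⟨ same ⟩
        ⟦ a ⇒ b ⟧ a    ≡⟨ ⇒-source a b ⟩
        b              ∎)
      cases (no x≢a)  (no y≢a)   = ⊥-elim (x≢y (begin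
        x              ≡⟨ sym (⇒-fixes x≢a) ⟩
        ⟦ a ⇒ b ⟧ x    ≡⟨ same ⟩
        ⟦ a ⇒ b ⟧ y    ≡⟨ ⇒-fixes y≢a ⟩
        y              ∎))

  ⇒-absorb : ∀ {u v u' v' : Fin n} → OneOf u' v' u → OneOf u' v' v →
             (⟦ u ⇒ v ⟧ · ⟦ u' ⇒ v' ⟧) ≈ ⟦ u' ⇒ v' ⟧
  ⇒-absorb {u} {v} {u'} {v'} u∈ v∈ x with x ≟ u
  ... | yes refl = trans (⇒-onPair v∈) (sym (⇒-onPair u∈))
  ... | no  _    = refl

  pair-exhausts : ∀ {a b u v w : Fin n} → u ≢ v →
                  OneOf a b u → OneOf a b v → OneOf a b w → OneOf u v w
  pair-exhausts u≢v (inj₁ refl) (inj₁ refl) _ = ⊥-elim (u≢v refl)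
  pair-exhausts u≢v (inj₂ refl) (inj₂ refl) _ = ⊥-elim (u≢v refl)
  pair-exhausts _ (inj₁ refl) (inj₂ refl) w∈ = w∈
  pair-exhausts _ (inj₂ refl) (inj₁ refl) (inj₁ w≡a) = inj₂ w≡a
  pair-exhausts _ (inj₂ refl) (inj₁ refl) (inj₂ w≡b) = inj₁ w≡b

open Elementary

≤R-kernel : ∀ {n} {D : Digraph n} {f g : Trans n} {x y : Fin n} →
            f ∈ g ·S¹[ D ] → g x ≡ g y → f x ≡ f y
≤R-kernel {x = x} {y} (inj₁ f≈g) gx≡gy =
  trans (f≈g x) (trans gx≡gy (sym (f≈g y)))
≤R-kernel {x = x} {y} (inj₂ (s , _ , f≈gs)) gx≡gy =
  trans (f≈gs x) (trans (cong s gx≡gy) (sym (f≈gs y)))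

module _ {n : ℕ} (D : Digraph n) where

  arc-distinct : ∀ {u v} → Arc D u v → u ≢ v
  arc-distinct {u} e refl = loopless D u e

  ArcsWithin : Fin n → Fin n → Set
  ArcsWithin a b = ∀ {u v} → Arc D u v → OneOf a b u × OneOf a b v

  ComponentsWithin : Fin n → Fin n → Set
  ComponentsWithin a b = ∀ x y → x ≢ y → Connected D x y → OneOf a b x

  components⇒arcs : ∀ {a b} → ComponentsWithin a b → ArcsWithin a b
  components⇒arcs within e =
    within _ _ (arc-distinct e) (fwd e ◅ ε) ,
    within _ _ (≢-sym (arc-distinct e)) (bwd e ◅ ε)

  arcs⇒components : ∀ {a b} → ArcsWithin a b → ComponentsWithin a b
  arcs⇒components within x y x≢y ε            = ⊥-elim (x≢y refl)
  arcs⇒components within x y x≢y (fwd e ◅ _)  = proj₁ (within e)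
  arcs⇒components within x y x≢y (bwd e ◅ _)  = proj₂ (within e)

  rightZero-fromGenerators :
    (∀ {a b c d} → Arc D a b → Arc D c d → (⟦ a ⇒ b ⟧ · ⟦ c ⇒ d ⟧) ≈ ⟦ c ⇒ d ⟧) →
    RightZero D
  rightZero-fromGenerators generators _ _ = right
    where
      -- (f₁ f₂) t = f₁ (f₂ t) = f₁ t = t.
      onGenerator : ∀ {f c d} → ⟨ D ⟩ f → Arc D c d → (f · ⟦ c ⇒ d ⟧) ≈ ⟦ c ⇒ d ⟧
      onGenerator (gen e) e' x = generators e e' x
      onGenerator (comp {f₁} pf₁ pf₂) e' x =
        trans (onGenerator pf₂ e' (f₁ x)) (onGenerator pf₁ e' x)

      -- f (g₁ g₂) = (f g₁) g₂ = g₁ g₂.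
      right : ∀ {f g} → ⟨ D ⟩ f → ⟨ D ⟩ g → (f · g) ≈ g
      right pf (gen e')              = onGenerator pf e'
      right pf (comp {g = g₂} pg₁ _) x = cong g₂ (right pf pg₁ x)

  -- (iii) ⇒ (i): all arcs join the same two vertices, so the generators
  -- absorb each other from the left.
  component⇒rightZero : UniqueNontrivialComponentOfSize2 D → RightZero D
  component⇒rightZero (a , b , _ , _ , within) = rightZero-fromGenerators absorbs
    where
      arcsWithin : ArcsWithin a b
      arcsWithin = components⇒arcs within

      sameEnds : ∀ {u v c d} → Arc D u v → Arc D c d → OneOf c d u × OneOf c d v
      sameEnds e e' with arcsWithin e | arcsWithin e'
      ... | u∈ , v∈ | c∈ , d∈ =
        pair-exhausts (arc-distinct e') c∈ d∈ u∈ ,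
        pair-exhausts (arc-distinct e') c∈ d∈ v∈

      absorbs : ∀ {u v c d} → Arc D u v → Arc D c d →
                (⟦ u ⇒ v ⟧ · ⟦ c ⇒ d ⟧) ≈ ⟦ c ⇒ d ⟧
      absorbs e e' = ⇒-absorb (proj₁ (sameEnds e e')) (proj₂ (sameEnds e e'))

  -- (i) ⇒ (ii): in a right zero semigroup f = g f for all f, g; a generator
  -- witnesses non-emptiness.
  rightZero⇒uniqueR : (∃[ a ] ∃[ b ] Arc D a b) → RightZero D → UniqueRClass D
  rightZero⇒uniqueR (_ , _ , e) rz = (_ , gen e) , λ f g pf pg →
    inj₂ (f , pf , λ x → sym (rz g f pg pf x)) ,
    inj₂ (g , pg , λ x → sym (rz f g pf pg x))

  -- (ii) ⇒ (iii): fix an arc (a, b).  For any arc (u, v), (a → b) ≤_R (u → v)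
  -- and (u → v) identifies u and v, hence so does (a → b); by the kernel of
  -- (a → b), both u and v lie in {a, b}.
  uniqueR⇒component : (∃[ a ] ∃[ b ] Arc D a b) → UniqueRClass D →
                      UniqueNontrivialComponentOfSize2 D
  uniqueR⇒component (a , b , e) (_ , related) =
    a , b , arc-distinct e , fwd e ◅ ε , arcs⇒components arcsWithin
    where
      identifies : ∀ {u v} → Arc D u v → ⟦ a ⇒ b ⟧ u ≡ ⟦ a ⇒ b ⟧ v
      identifies {u} {v} e' =
        ≤R-kernel {x = u} {y = v} (proj₁ (related _ _ (gen e) (gen e')))
                  (trans (⇒-source u v) (sym (⇒-onPair {a = u} (inj₂ refl))))

      arcsWithin : ArcsWithin a b
      arcsWithin e' = ⇒-collapse (identifies e') (arc-distinct e') ,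
                      ⇒-collapse (sym (identifies e')) (≢-sym (arc-distinct e'))

proposition6p5 : (n : ℕ) (D : Digraph n) → (∃[ a ] ∃[ b ] Arc D a b) →
    (RightZero D ⇔ UniqueRClass D) × (UniqueRClass D ⇔ UniqueNontrivialComponentOfSize2 D)
proposition6p5 n D hasArc =
  mk⇔ i⇒ii (λ ii → iii⇒i (ii⇒iii ii)) ,
  mk⇔ ii⇒iii (λ iii → i⇒ii (iii⇒i iii))
  where
    i⇒ii : RightZero D → UniqueRClass D
    i⇒ii = rightZero⇒uniqueR D hasArc

    ii⇒iii : UniqueRClass D → UniqueNontrivialComponentOfSize2 D
    ii⇒iii = uniqueR⇒component D hasArc

    iii⇒i : UniqueNontrivialComponentOfSize2 D → RightZero D
    iii⇒i = component⇒rightZero D
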